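{- For all integers $n, m \geq 0$ and $k \geq 1$, \[ C(n,m,\widehat k) = E_m(n+mk,k) = \sum_{j \geq m} (-1)^{j-m}\binom{j}{m}a(j,n-k(j-m)). \]
   Context: A composition of an integer $N \ge 0$ is a finite sequence of positive integers (parts) summing to $N$ (the empty sequence is the unique composition of $0$). For integers $r \geq 0$ and $N$, $a(r,N)$ denotes the number of ways to tile a $1 \times (N+r)$ grid using $r$ indistinguishable red $1\times1$ squares and white tiles of arbitrary positive integer lengths with total white length $N$ (order of tiles matters), and $a(r,N)=0$ if $N<0$. $C(n,m,\widehat k)$ denotes the number of such tilings of a $1\times(n+m)$ grid with $m$ red squares in which no white tile has length $k$ (white total length $n$). $E_p(N,k)$ denotes the number of compositions of $N$ having exactly $p$ parts equal to $k$. -}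

module Defs where

open import Data.Nat using (ℕ; zero; suc; _+_; _*_; _∸_; _≟_)
open import Data.Nat.Combinatorics using (_C_)
open import Data.Integer as ℤ using (ℤ; +_; -[1+_])
open import Data.List using (List; []; _∷_; map; concatMap; filter; length; upTo; sum; foldr; all)
open import Data.Bool using (Bool; true; false; not)
open import Relation.Nullary using (yes; no)
open import Relation.Nullary.Decidable using (⌊_⌋; _×-dec_)
import Data.Bool.Properties as BoolP
open import Data.Bool using (_∨_)
open import Data.List using (_++_)
open import Relation.Binary.PropositionalEquality using (_≡_)

data Tile : Set where
  red   : Tile
  white : ℕ → Tile          -- white j has length suc j

tileLen : Tile → ℕ
tileLen red       = 1
tileLen (white j) = suc j

reds : List Tile → ℕ
reds []             = 0
reds (red ∷ t)      = suc (reds t)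
reds (white _ ∷ t)  = reds t

whiteLen : List Tile → ℕ
whiteLen []            = 0
whiteLen (red ∷ t)     = whiteLen t
whiteLen (white j ∷ t) = suc j + whiteLen t

hasWhiteOfLen : ℕ → List Tile → Bool
hasWhiteOfLen k []            = false
hasWhiteOfLen k (red ∷ t)     = hasWhiteOfLen k t
hasWhiteOfLen k (white j ∷ t) = ⌊ suc j ≟ k ⌋ ∨ hasWhiteOfLen k t

-- Enumeration of ALL tilings (tile sequences) of a 1×L grid.
-- fuel ≥ L suffices since every tile has length ≥ 1.
tilingsF : ℕ → ℕ → List (List Tile)
tilingsF _        zero    = [] ∷ []
tilingsF zero     (suc _) = []
tilingsF (suc f)  (suc L) =
  map (red ∷_) (tilingsF f L) ++
  concatMap (λ j → map (white j ∷_) (tilingsF f (L ∸ j))) (upTo (suc L))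

tilings : ℕ → List (List Tile)
tilings L = tilingsF L L

aℕ : ℕ → ℕ → ℕ
aℕ r N = length (filter (λ t → (reds t ≟ r) ×-dec (whiteLen t ≟ N)) (tilings (N + r)))

a : ℕ → ℤ → ℕ
a r (+ N)     = aℕ r N
a r -[1+ _ ]  = 0

Chat : ℕ → ℕ → ℕ → ℕ
Chat n m k = length (filter
  (λ t → ((reds t ≟ m) ×-dec (whiteLen t ≟ n))
          ×-dec (BoolP._≟_ (hasWhiteOfLen k t) false))
  (tilings (n + m)))

compsF : ℕ → ℕ → List (List ℕ)
compsF _       zero    = [] ∷ []
compsF zero    (suc _) = []
compsF (suc f) (suc N) =
  concatMap (λ j → map (suc j ∷_) (compsF f (N ∸ j))) (upTo (suc N))

compositions : ℕ → List (List ℕ)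
compositions N = compsF N N

countParts : ℕ → List ℕ → ℕ
countParts k []      = 0
countParts k (x ∷ c) with x ≟ k
... | yes _ = suc (countParts k c)
... | no  _ = countParts k c

E : ℕ → ℕ → ℕ → ℕ
E p N k = length (filter (λ c → countParts k c ≟ p) (compositions N))

Σℤ : ℕ → (ℕ → ℤ) → ℤ
Σℤ zero    f = f 0
Σℤ (suc B) f = Σℤ B f ℤ.+ f (suc B)

sgn : ℕ → ℤ
sgn zero    = + 1
sgn (suc i) = ℤ.- sgn i

-- Σ_{j ≥ m} (-1)^{j-m} C(j,m) a(j, n - k(j-m)), written with i = j - m.
-- Terms with i > n vanish when k ≥ 1 (second argument of a is negative),
-- so the sum is truncated at i = n.
altSum : ℕ → ℕ → ℕ → ℤ
altSum n m k = Σℤ n (λ i →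
  sgn i ℤ.* (+ ((m + i) C m)) ℤ.* (+ a (m + i) (+ n ℤ.- + (k * i))))

module Submission where

-- The proof is by a common recurrence.  For a set w of allowed white lengths,
--   X(n,m) = [n = m = 0] + X(n, m-1) + Σ_{l < n, w l} X(n-1-l, m),  X(n,-1) = 0,
-- has at most one solution (induction on m, then on n), and all three
-- quantities of the theorem solve it with only the length k forbidden:
--  * C(n,m,k̂): split a tiling after its first tile, a red square or a white tile;
--  * E_m(n+mk,k): split a composition after its first part; a part k plays the
--    role of a red square, and E_m(N,k) = 0 when N < mk;
--  * Σ_i (-1)^i C(m+i,m) a(m+i, n-ki): expand every a by the same first-tile
--    recurrence with all lengths allowed; Pascal's rule turns the red-first terms
--    into the sum for (n, m-1) minus the sum for (n-k, m), and the latter is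
--    exactly the forbidden term l = k-1 of the convolution.

open import Defs
open import Data.Nat as ℕ using (ℕ; zero; suc; _∸_; _≤_; _<_; z≤n; s≤s; _≡ᵇ_)
import Data.Nat.Properties as ℕP
open import Data.Integer using (ℤ; +_; -[1+_])
import Data.Integer.Properties as ℤP
open import Data.Integer.Tactic.RingSolver using (solve-∀)
open import Data.List using (List; []; _∷_; map; concatMap; filter; length; upTo; applyUpTo; _++_)
open import Data.Bool using (Bool; true; false; if_then_else_; not)
open import Relation.Nullary using (does)
open import Relation.Unary using (Decidable)
open import Relation.Binary.PropositionalEquality
open import Function using (_∘_)

module Arithmetic where

  open import Data.Bool using (T)
  import Data.Nat.Tactic.RingSolver as ℕSolver

  +-≡ᵇ : ∀ j x n → j ≤ n → (j ℕ.+ x ≡ᵇ n) ≡ (x ≡ᵇ n ∸ j)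
  +-≡ᵇ zero    x n       _         = refl
  +-≡ᵇ (suc j) x (suc n) (s≤s j≤n) = +-≡ᵇ j x n j≤n

  +-≡ᵇ-over : ∀ j x n → n < j → (j ℕ.+ x ≡ᵇ n) ≡ false
  +-≡ᵇ-over (suc j) x zero    _         = refl
  +-≡ᵇ-over (suc j) x (suc n) (s≤s n<j) = +-≡ᵇ-over j x n n<j

  ≡ᵇ-refl : ∀ n → (n ≡ᵇ n) ≡ true
  ≡ᵇ-refl zero    = refl
  ≡ᵇ-refl (suc n) = ≡ᵇ-refl n

  ≡ᵇ-sound : ∀ m n → (m ≡ᵇ n) ≡ true → m ≡ n
  ≡ᵇ-sound m n eq = ℕP.≡ᵇ⇒≡ m n (subst T (sym eq) _)

  after-part : ∀ {n X s} k0 → n ℕ.+ (suc k0 ℕ.+ X) ≡ suc s → s ≡ k0 ℕ.+ (n ℕ.+ X)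
  after-part {n} {X} k0 eq = ℕP.suc-injective (trans (sym eq) (shuffle n k0 X))
    where
    shuffle : ∀ n k0 X → n ℕ.+ (suc k0 ℕ.+ X) ≡ suc (k0 ℕ.+ (n ℕ.+ X))
    shuffle = ℕSolver.solve-∀

  after-k : ∀ {s X} k0 → suc s ℕ.< suc k0 ℕ.+ X → k0 ≤ s → s ∸ k0 ℕ.< X
  after-k {s} {X} k0 s<k0+X k0≤s = subst (s ∸ k0 ℕ.<_) (ℕP.m+n∸m≡n k0 X)
    (ℕP.∸-monoˡ-< {s} {k0} {k0 ℕ.+ X} (ℕP.≤-pred s<k0+X) k0≤s)

  remaining-short : ∀ {n M s j} → n ℕ.+ M ≡ suc s → j < n → s ∸ j ≡ n ∸ suc j ℕ.+ M
  remaining-short {M = M} {j = j} eq j<n =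
    trans (cong (_∸ suc j) (sym eq)) (ℕP.+-∸-comm M j<n)

  remaining-long : ∀ {n M s j} → n ℕ.+ M ≡ suc s → n ≤ j → j ≤ s → s ∸ j ℕ.< M
  remaining-long {n} {M} {s} {j} eq n≤j j≤s = ℕP.+-cancelʳ-< n (s ∸ j) M (begin-strict
    s ∸ j ℕ.+ n   ≤⟨ ℕP.+-monoʳ-≤ (s ∸ j) n≤j ⟩
    s ∸ j ℕ.+ j   ≡⟨ ℕP.m∸n+n≡m j≤s ⟩
    s             <⟨ ℕP.n<1+n s ⟩
    suc s         ≡⟨ trans (sym eq) (ℕP.+-comm n M) ⟩
    M ℕ.+ n       ∎)
    where open ℕP.≤-Reasoning

  summand≤total : ∀ {n M s} → n ℕ.+ M ≡ suc s → n ≤ suc s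
  summand≤total {n} {M} eq = subst (n ≤_) eq (ℕP.m≤m+n n M)

module Counting where

  open import Data.Bool using (_∧_)

  count : {A : Set} → (A → Bool) → List A → ℕ
  count p []       = 0
  count p (x ∷ xs) = if p x then suc (count p xs) else count p xs

  length-filter≡count : {A : Set} {P : A → Set} (P? : Decidable P) (xs : List A) →
    length (filter P? xs) ≡ count (λ x → does (P? x)) xs
  length-filter≡count P? []       = refl
  length-filter≡count P? (x ∷ xs) with does (P? x)
  ... | true  = cong suc (length-filter≡count P? xs)
  ... | false = length-filter≡count P? xs

  count-++ : {A : Set} (p : A → Bool) (xs ys : List A) →
    count p (xs ++ ys) ≡ count p xs ℕ.+ count p ys
  count-++ p []       ys = refl
  count-++ p (x ∷ xs) ys with p x
  ... | true  = cong suc (count-++ p xs ys)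
  ... | false = count-++ p xs ys

  count-map : {A B : Set} (p : B → Bool) (f : A → B) (xs : List A) →
    count p (map f xs) ≡ count (p ∘ f) xs
  count-map p f []       = refl
  count-map p f (x ∷ xs) with p (f x)
  ... | true  = cong suc (count-map p f xs)
  ... | false = count-map p f xs

  count-cong : {A : Set} {p q : A → Bool} → (∀ x → p x ≡ q x) → (xs : List A) →
    count p xs ≡ count q xs
  count-cong           p≗q []       = refl
  count-cong {q = q} p≗q (x ∷ xs) rewrite p≗q x with q x
  ... | true  = cong suc (count-cong p≗q xs)
  ... | false = count-cong p≗q xs

  count-none : {A : Set} {p : A → Bool} → (∀ x → p x ≡ false) → (xs : List A) → count p xs ≡ 0
  count-none p≗false []       = refl
  count-none p≗false (x ∷ xs) rewrite p≗false x = count-none p≗false xs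

  count-guard : {A : Set} (b : Bool) (q : A → Bool) (xs : List A) →
    + count (λ x → b ∧ q x) xs ≡ (if b then + count q xs else + 0)
  count-guard true  q xs = refl
  count-guard false q xs = cong +_ (count-none (λ _ → refl) xs)

module Sums where

  open import Data.Integer using (_+_; _*_; -_)
  open Arithmetic
  open Counting

  ∑< : ℕ → (ℕ → ℤ) → ℤ
  ∑< zero    f = + 0
  ∑< (suc n) f = f 0 + ∑< n (f ∘ suc)

  ∑-cong : ∀ n {f g : ℕ → ℤ} → (∀ j → j < n → f j ≡ g j) → ∑< n f ≡ ∑< n g
  ∑-cong zero    f≗g = refl
  ∑-cong (suc n) f≗g =
    cong₂ _+_ (f≗g 0 (s≤s z≤n)) (∑-cong n (λ j j<n → f≗g (suc j) (s≤s j<n)))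

  ∑-zero : ∀ n {f : ℕ → ℤ} → (∀ j → j < n → f j ≡ + 0) → ∑< n f ≡ + 0
  ∑-zero zero    f≗0 = refl
  ∑-zero (suc n) f≗0 =
    cong₂ _+_ (f≗0 0 (s≤s z≤n)) (∑-zero n (λ j j<n → f≗0 (suc j) (s≤s j<n)))

  ∑-truncate : ∀ {n N} {f : ℕ → ℤ} → n ≤ N → (∀ j → n ≤ j → j < N → f j ≡ + 0) →
    ∑< N f ≡ ∑< n f
  ∑-truncate {zero}  {N}           _         f≗0 = ∑-zero N (λ j → f≗0 j z≤n)
  ∑-truncate {suc n} {suc N} {f} (s≤s n≤N) f≗0 =
    cong (λ s → f 0 + s) (∑-truncate n≤N (λ j n≤j j<N → f≗0 (suc j) (s≤s n≤j) (s≤s j<N)))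

  ∑-+ : ∀ n (f g : ℕ → ℤ) → ∑< n (λ j → f j + g j) ≡ ∑< n f + ∑< n g
  ∑-+ zero    f g = refl
  ∑-+ (suc n) f g rewrite ∑-+ n (f ∘ suc) (g ∘ suc) = interchange (f 0) (g 0) _ _
    where
    interchange : ∀ a b c d → (a + b) + (c + d) ≡ (a + c) + (b + d)
    interchange = solve-∀

  ∑-scale : ∀ n (c : ℤ) (f : ℕ → ℤ) → c * ∑< n f ≡ ∑< n (λ j → c * f j)
  ∑-scale zero    c f = ℤP.*-zeroʳ c
  ∑-scale (suc n) c f =
    trans (ℤP.*-distribˡ-+ c (f 0) _) (cong (λ s → c * f 0 + s) (∑-scale n c (f ∘ suc)))

  ∑-neg : ∀ n (f : ℕ → ℤ) → ∑< n (λ j → - f j) ≡ - ∑< n f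
  ∑-neg zero    f = refl
  ∑-neg (suc n) f =
    trans (cong (λ s → - f 0 + s) (∑-neg n (f ∘ suc))) (sym (ℤP.neg-distrib-+ (f 0) _))

  ∑-swap : ∀ B L (H : ℕ → ℕ → ℤ) →
    ∑< B (λ i → ∑< L (H i)) ≡ ∑< L (λ l → ∑< B (λ i → H i l))
  ∑-swap zero    L H = sym (∑-zero L (λ _ _ → refl))
  ∑-swap (suc B) L H =
    trans (cong (λ s → ∑< L (H 0) + s) (∑-swap B L (H ∘ suc))) (sym (∑-+ L (H 0) _))

  ∑-snoc : ∀ n (f : ℕ → ℤ) → ∑< (suc n) f ≡ ∑< n f + f n
  ∑-snoc zero    f = trans (ℤP.+-identityʳ (f 0)) (sym (ℤP.+-identityˡ (f 0)))
  ∑-snoc (suc n) f =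
    trans (cong (λ s → f 0 + s) (∑-snoc n (f ∘ suc))) (sym (ℤP.+-assoc (f 0) _ (f (suc n))))

  Σℤ≡∑< : ∀ B (f : ℕ → ℤ) → Σℤ B f ≡ ∑< (suc B) f
  Σℤ≡∑< zero    f = sym (ℤP.+-identityʳ (f 0))
  Σℤ≡∑< (suc B) f = trans (cong (_+ f (suc B)) (Σℤ≡∑< B f)) (sym (∑-snoc (suc B) f))

  count-concatMap : {A B : Set} (p : B → Bool) (h : A → List B) (g : ℕ → A) (n : ℕ) →
    + count p (concatMap h (applyUpTo g n)) ≡ ∑< n (λ j → + count p (h (g j)))
  count-concatMap p h g zero    = refl
  count-concatMap p h g (suc n) = begin
    + count p (h (g 0) ++ concatMap h (applyUpTo (g ∘ suc) n))
      ≡⟨ cong +_ (count-++ p (h (g 0)) _) ⟩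
    + count p (h (g 0)) + + count p (concatMap h (applyUpTo (g ∘ suc) n))
      ≡⟨ cong (λ s → + count p (h (g 0)) + s) (count-concatMap p h (g ∘ suc) n) ⟩
    + count p (h (g 0)) + ∑< n (λ j → + count p (h (g (suc j))))
      ∎
    where open ≡-Reasoning

  ∑[_] : (ℕ → Bool) → ℕ → (ℕ → ℤ) → ℤ
  ∑[ w ] n f = ∑< n (λ j → if w j then f j else + 0)

  _≢ᵇ_ : ℕ → ℕ → Bool
  j ≢ᵇ i = not (j ≡ᵇ i)

  ∑-omit : ∀ i n (f : ℕ → ℤ) → i < n → ∑< n f ≡ ∑[ _≢ᵇ i ] n f + f i
  ∑-omit zero    (suc n) f _ = comm (f 0) (∑< n (f ∘ suc))
    where
    comm : ∀ a b → a + b ≡ (+ 0 + b) + a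
    comm = solve-∀
  ∑-omit (suc i) (suc n) f (s≤s i<n) =
    trans (cong (λ s → f 0 + s) (∑-omit i n (f ∘ suc) i<n)) (sym (ℤP.+-assoc (f 0) _ (f (suc i))))

  ∑[]-cong : ∀ w n {f g : ℕ → ℤ} → (∀ j → j < n → f j ≡ g j) →
    ∑[ w ] n f ≡ ∑[ w ] n g
  ∑[]-cong w n f≗g = ∑-cong n (λ j j<n → cong (λ v → if w j then v else + 0) (f≗g j j<n))

  ∑[]-truncate : ∀ w {n N} {f : ℕ → ℤ} → n ≤ N →
    (∀ j → n ≤ j → j < N → f j ≡ + 0) →
    ∑[ w ] N f ≡ ∑[ w ] n f
  ∑[]-truncate w n≤N f≗0 = ∑-truncate n≤N (λ j n≤j j<N → masked (w j) (f≗0 j n≤j j<N))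
    where
    masked : ∀ b {x} → x ≡ + 0 → (if b then x else + 0) ≡ + 0
    masked true  x≡0 = x≡0
    masked false _   = refl

  ∑-select : ∀ i n (g h : ℕ → ℤ) → i < n →
    ∑< n (λ j → if j ≡ᵇ i then g j else h j) ≡ ∑[ _≢ᵇ i ] n h + g i
  ∑-select i n g h i<n = begin
    ∑< n f                 ≡⟨ ∑-omit i n f i<n ⟩
    ∑[ _≢ᵇ i ] n f + f i   ≡⟨ cong₂ _+_ (∑-cong n (λ j _ → masked j))
                                        (cong (λ b → if b then g i else h i) (≡ᵇ-refl i)) ⟩
    ∑[ _≢ᵇ i ] n h + g i   ∎
    where
    open ≡-Reasoning
    f : ℕ → ℤ
    f j = if j ≡ᵇ i then g j else h j
    masked : ∀ j → (if j ≢ᵇ i then f j else + 0) ≡ (if j ≢ᵇ i then h j else + 0)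
    masked j with j ≡ᵇ i
    ... | true  = refl
    ... | false = refl

  ∑-select-zero : ∀ i n (h : ℕ → ℤ) →
    ∑< n (λ j → if j ≡ᵇ i then + 0 else h j) ≡ ∑[ _≢ᵇ i ] n h
  ∑-select-zero i n h = ∑-cong n (λ j _ → flip (j ≡ᵇ i))
    where
    flip : ∀ b {x} → (if b then + 0 else x) ≡ (if not b then x else + 0)
    flip true  = refl
    flip false = refl

  ∑-omit-absent : ∀ i n (f : ℕ → ℤ) → n ≤ i → ∑[ _≢ᵇ i ] n f ≡ ∑< n f
  ∑-omit-absent i       zero    f _         = refl
  ∑-omit-absent (suc i) (suc n) f (s≤s n≤i) =
    cong (λ s → f 0 + s) (∑-omit-absent i n (f ∘ suc) n≤i)

-- The enumerations of the definitions only depend on their fuel once it is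
-- large enough, so `tilings (suc L)` and `compositions (suc N)` unfold into
-- their first tile (part) followed by a smaller enumeration.
module Enumerations where

  open import Data.Integer using (_+_)
  open Counting
  open Sums
  open import Data.List.Properties using (concatMap-cong)

  tilingsF-fuel : ∀ {f f'} L → L ≤ f → L ≤ f' → tilingsF f L ≡ tilingsF f' L
  tilingsF-fuel zero _ _ = refl
  tilingsF-fuel {suc f} {suc f'} (suc L) (s≤s L≤f) (s≤s L≤f') =
    cong₂ _++_ (cong (map (red ∷_)) (tilingsF-fuel L L≤f L≤f'))
      (concatMap-cong (λ j → cong (map (white j ∷_)) (tilingsF-fuel (L ∸ j)
          (ℕP.≤-trans (ℕP.m∸n≤m L j) L≤f) (ℕP.≤-trans (ℕP.m∸n≤m L j) L≤f')))
        (upTo (suc L)))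

  count-tilings-suc : ∀ (p : List Tile → Bool) L →
    + count p (tilings (suc L)) ≡
      + count (p ∘ (red ∷_)) (tilings L)
      + ∑< (suc L) (λ j → + count (p ∘ (white j ∷_)) (tilings (L ∸ j)))
  count-tilings-suc p L = begin
    + count p (map (red ∷_) (tilings L) ++ concatMap whiteFirst (upTo (suc L)))
      ≡⟨ cong +_ (count-++ p (map (red ∷_) (tilings L)) _) ⟩
    + count p (map (red ∷_) (tilings L)) + + count p (concatMap whiteFirst (upTo (suc L)))
      ≡⟨ cong₂ _+_ (cong +_ (count-map p (red ∷_) (tilings L)))
                   (count-concatMap p whiteFirst (λ j → j) (suc L)) ⟩
    + count (p ∘ (red ∷_)) (tilings L) + ∑< (suc L) (λ j → + count p (whiteFirst j))
      ≡⟨ cong (λ s → + count (p ∘ (red ∷_)) (tilings L) + s)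
              (∑-cong (suc L) (λ j _ → cong +_ (count-map p (white j ∷_) (tilingsF L (L ∸ j))))) ⟩
    + count (p ∘ (red ∷_)) (tilings L)
      + ∑< (suc L) (λ j → + count (p ∘ (white j ∷_)) (tilingsF L (L ∸ j)))
      ≡⟨ cong (λ s → + count (p ∘ (red ∷_)) (tilings L) + s)
              (∑-cong (suc L) (λ j _ → cong (λ ts → + count (p ∘ (white j ∷_)) ts)
                (tilingsF-fuel (L ∸ j) (ℕP.m∸n≤m L j) ℕP.≤-refl))) ⟩
    + count (p ∘ (red ∷_)) (tilings L)
      + ∑< (suc L) (λ j → + count (p ∘ (white j ∷_)) (tilings (L ∸ j)))
      ∎
    where
    open ≡-Reasoning
    whiteFirst : ℕ → List (List Tile)
    whiteFirst j = map (white j ∷_) (tilingsF L (L ∸ j))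

  compsF-fuel : ∀ {f f'} N → N ≤ f → N ≤ f' → compsF f N ≡ compsF f' N
  compsF-fuel zero _ _ = refl
  compsF-fuel {suc f} {suc f'} (suc N) (s≤s N≤f) (s≤s N≤f') =
    concatMap-cong (λ j → cong (map (suc j ∷_)) (compsF-fuel (N ∸ j)
        (ℕP.≤-trans (ℕP.m∸n≤m N j) N≤f) (ℕP.≤-trans (ℕP.m∸n≤m N j) N≤f')))
      (upTo (suc N))

  count-compositions-suc : ∀ (p : List ℕ → Bool) N →
    + count p (compositions (suc N)) ≡
      ∑< (suc N) (λ j → + count (p ∘ (suc j ∷_)) (compositions (N ∸ j)))
  count-compositions-suc p N = begin
    + count p (concatMap firstPart (upTo (suc N)))
      ≡⟨ count-concatMap p firstPart (λ j → j) (suc N) ⟩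
    ∑< (suc N) (λ j → + count p (firstPart j))
      ≡⟨ ∑-cong (suc N) (λ j _ → cong +_ (trans (count-map p (suc j ∷_) (compsF N (N ∸ j)))
           (cong (count (p ∘ (suc j ∷_)))
                 (compsF-fuel (N ∸ j) (ℕP.m∸n≤m N j) ℕP.≤-refl)))) ⟩
    ∑< (suc N) (λ j → + count (p ∘ (suc j ∷_)) (compositions (N ∸ j)))
      ∎
    where
    open ≡-Reasoning
    firstPart : ℕ → List (List ℕ)
    firstPart j = map (suc j ∷_) (compsF N (N ∸ j))

module Recurrence where

  open import Data.Integer using (_+_)
  open Counting
  open Sums
  open Enumerations
  open Arithmetic
  open import Data.Bool using (_∧_)
  import Data.Bool.Properties as BoolP
  open import Data.Empty using (⊥-elim)

  unit : ℕ → ℕ → ℤ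
  unit zero    zero    = + 1
  unit zero    (suc _) = + 0
  unit (suc _) _       = + 0

  below : (ℕ → ℕ → ℤ) → ℕ → ℕ → ℤ
  below X n zero    = + 0
  below X n (suc m) = X n m

  Recurrence : (ℕ → Bool) → (ℕ → ℕ → ℤ) → Set
  Recurrence w X = ∀ n m →
    X n m ≡ unit n m + below X n m + ∑[ w ] n (λ l → X (n ∸ suc l) m)

  recurrence-unique : ∀ {w X Y} → Recurrence w X → Recurrence w Y → ∀ n m → X n m ≡ Y n m
  recurrence-unique {w} {X} {Y} recX recY n m = agree m n n ℕP.≤-refl
    where
    agree : ∀ m N n → n ≤ N → X n m ≡ Y n m
    agree m N n n≤N = begin
      X n m
        ≡⟨ recX n m ⟩
      unit n m + below X n m + ∑[ w ] n (λ l → X (n ∸ suc l) m)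
        ≡⟨ cong₂ (λ b s → unit n m + b + s) (belowAgree m) (tailAgree N n≤N) ⟩
      unit n m + below Y n m + ∑[ w ] n (λ l → Y (n ∸ suc l) m)
        ≡⟨ recY n m ⟨
      Y n m
        ∎
      where
      open ≡-Reasoning
      belowAgree : ∀ m → below X n m ≡ below Y n m
      belowAgree zero     = refl
      belowAgree (suc m') = agree m' N n n≤N
      tailAgree : ∀ N → n ≤ N →
        ∑[ w ] n (λ l → X (n ∸ suc l) m) ≡ ∑[ w ] n (λ l → Y (n ∸ suc l) m)
      tailAgree zero     z≤n   = refl
      tailAgree (suc N') n≤sN' = ∑-cong n (λ l _ → cong (λ v → if w l then v else + 0)
        (agree m N' (n ∸ suc l)
          (ℕP.≤-trans (ℕP.∸-monoʳ-≤ n (s≤s z≤n)) (ℕP.∸-monoˡ-≤ 1 n≤sN'))))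

  whitesAllowed : (ℕ → Bool) → List Tile → Bool
  whitesAllowed w []            = true
  whitesAllowed w (red ∷ t)     = whitesAllowed w t
  whitesAllowed w (white j ∷ t) = w j ∧ whitesAllowed w t

  isTiling : (ℕ → Bool) → ℕ → ℕ → List Tile → Bool
  isTiling w n m t = whitesAllowed w t ∧ ((reds t ≡ᵇ m) ∧ (whiteLen t ≡ᵇ n))

  tilingCount : (ℕ → Bool) → ℕ → ℕ → ℤ
  tilingCount w n m = + count (isTiling w n m) (tilings (n ℕ.+ m))

  -- Away from (n, m) = (0, 0) the unit term is zero; the hypotheses say that
  -- n + M > 0 for some M that vanishes with m.
  add-unit : ∀ {n m M L} → n ℕ.+ M ≡ suc L → (m ≡ 0 → M ≡ 0) →
    ∀ b s → b + s ≡ unit n m + b + s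
  add-unit {zero}  {zero}  total M≡0 b s = ⊥-elim (ℕP.0≢1+n (trans (sym (M≡0 refl)) total))
  add-unit {zero}  {suc _} _     _   b s = cong (_+ s) (sym (ℤP.+-identityˡ b))
  add-unit {suc _}         _     _   b s = cong (_+ s) (sym (ℤP.+-identityˡ b))

  tilingCount-step : ∀ w n m L → n ℕ.+ m ≡ suc L →
    tilingCount w n m ≡
      unit n m + below (tilingCount w) n m + ∑[ w ] n (λ l → tilingCount w (n ∸ suc l) m)
  tilingCount-step w n m L total = begin
    tilingCount w n m
      ≡⟨ cong (λ s → + count (isTiling w n m) (tilings s)) total ⟩
    + count (isTiling w n m) (tilings (suc L))
      ≡⟨ count-tilings-suc (isTiling w n m) L ⟩
    + count (isTiling w n m ∘ (red ∷_)) (tilings L) + ∑< (suc L) whiteFirst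
      ≡⟨ cong₂ _+_ (redFirst m total) (∑-truncate (summand≤total total) whiteFirst-long) ⟩
    below (tilingCount w) n m + ∑< n whiteFirst
      ≡⟨ cong (λ s → below (tilingCount w) n m + s) (∑-cong n whiteFirst-short) ⟩
    below (tilingCount w) n m + ∑[ w ] n (λ l → tilingCount w (n ∸ suc l) m)
      ≡⟨ add-unit {n} {m} total (λ m≡0 → m≡0) _ _ ⟩
    unit n m + below (tilingCount w) n m + ∑[ w ] n (λ l → tilingCount w (n ∸ suc l) m)
      ∎
    where
    open ≡-Reasoning
    whiteFirst : ℕ → ℤ
    whiteFirst j = + count (isTiling w n m ∘ (white j ∷_)) (tilings (L ∸ j))

    redFirst : ∀ m → n ℕ.+ m ≡ suc L →
      + count (isTiling w n m ∘ (red ∷_)) (tilings L) ≡ below (tilingCount w) n m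
    redFirst zero     _     = cong +_ (count-none (λ t → BoolP.∧-zeroʳ _) (tilings L))
    redFirst (suc m') total' = cong (λ s → + count (isTiling w n m') (tilings s))
      (ℕP.suc-injective (trans (sym total') (ℕP.+-suc n m')))

    whiteFirst-long : ∀ j → n ≤ j → j < suc L → whiteFirst j ≡ + 0
    whiteFirst-long j n≤j _ = cong +_ (count-none (λ t →
      trans (cong (λ b → (w j ∧ whitesAllowed w t) ∧ ((reds t ≡ᵇ m) ∧ b))
                  (+-≡ᵇ-over (suc j) (whiteLen t) n (s≤s n≤j)))
            (trans (cong ((w j ∧ whitesAllowed w t) ∧_) (BoolP.∧-zeroʳ _)) (BoolP.∧-zeroʳ _)))
      (tilings (L ∸ j)))

    whiteFirst-short : ∀ j → j < n →
      whiteFirst j ≡ (if w j then tilingCount w (n ∸ suc j) m else + 0)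
    whiteFirst-short j j<n = begin
      + count (isTiling w n m ∘ (white j ∷_)) (tilings (L ∸ j))
        ≡⟨ cong +_ (count-cong (λ t → trans (BoolP.∧-assoc (w j) _ _)
             (cong (λ b → w j ∧ (whitesAllowed w t ∧ ((reds t ≡ᵇ m) ∧ b)))
                   (+-≡ᵇ (suc j) (whiteLen t) n j<n))) (tilings (L ∸ j))) ⟩
      + count (λ t → w j ∧ isTiling w (n ∸ suc j) m t) (tilings (L ∸ j))
        ≡⟨ count-guard (w j) (isTiling w (n ∸ suc j) m) (tilings (L ∸ j)) ⟩
      (if w j then + count (isTiling w (n ∸ suc j) m) (tilings (L ∸ j)) else + 0)
        ≡⟨ cong (λ s → if w j then + count (isTiling w (n ∸ suc j) m) (tilings s) else + 0)
                (remaining-short total j<n) ⟩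
      (if w j then tilingCount w (n ∸ suc j) m else + 0)
        ∎

  tilingCount-recurrence : ∀ w → Recurrence w (tilingCount w)
  tilingCount-recurrence w zero    zero    = refl
  tilingCount-recurrence w zero    (suc m) = tilingCount-step w zero (suc m) m refl
  tilingCount-recurrence w (suc n) m       = tilingCount-step w (suc n) m (n ℕ.+ m) refl

module ForbiddenLength (k0 : ℕ) where

  open import Data.Integer using (_+_)
  open Arithmetic
  open Counting
  open Sums
  open Enumerations
  open Recurrence
  open import Data.Bool using (_∧_; _∨_)
  import Data.Bool.Properties as BoolP
  open import Relation.Nullary.Decidable using (isYes)
  open import Relation.Nullary using (Dec; _because_; yes; no)

  k : ℕ
  k = suc k0

  noWhiteK : List Tile → Bool
  noWhiteK t = does (hasWhiteOfLen k t BoolP.≟ false)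

  noWhiteK≡whitesAllowed : ∀ t → noWhiteK t ≡ whitesAllowed (_≢ᵇ k0) t
  noWhiteK≡whitesAllowed []            = refl
  noWhiteK≡whitesAllowed (red ∷ t)     = noWhiteK≡whitesAllowed t
  noWhiteK≡whitesAllowed (white j ∷ t) =
    trans (split (isYes (suc j ℕ.≟ k)) (hasWhiteOfLen k t))
          (cong₂ (λ b c → not b ∧ c) (isYes≡does (suc j ℕ.≟ k)) (noWhiteK≡whitesAllowed t))
    where
    split : ∀ a b → does ((a ∨ b) BoolP.≟ false) ≡ not a ∧ does (b BoolP.≟ false)
    split true  b     = refl
    split false true  = refl
    split false false = refl
    isYes≡does : {P : Set} (d : Dec P) → isYes d ≡ does d
    isYes≡does (true  because _) = refl
    isYes≡does (false because _) = refl

  Chat≡tilingCount : ∀ n m → + Chat n m k ≡ tilingCount (_≢ᵇ k0) n m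
  Chat≡tilingCount n m = cong +_ (trans (length-filter≡count _ (tilings (n ℕ.+ m)))
    (count-cong (λ t → trans (cong (((reds t ≡ᵇ m) ∧ (whiteLen t ≡ᵇ n)) ∧_)
                                   (noWhiteK≡whitesAllowed t))
                             (BoolP.∧-comm _ (whitesAllowed (_≢ᵇ k0) t)))
                (tilings (n ℕ.+ m))))

  hasParts : ℕ → List ℕ → Bool
  hasParts m c = countParts k c ≡ᵇ m

  partCount : ℕ → ℕ → ℤ
  partCount N m = + count (hasParts m) (compositions N)

  countParts-cons : ∀ j c →
    countParts k (suc j ∷ c) ≡ (if j ≡ᵇ k0 then suc (countParts k c) else countParts k c)
  countParts-cons j c with suc j ℕ.≟ k in eq
  ... | yes _ rewrite cong does eq = refl
  ... | no  _ rewrite cong does eq = refl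

  partCount-suc : ∀ N m → partCount (suc N) m ≡
    ∑< (suc N) (λ j → if j ≡ᵇ k0 then below partCount (N ∸ j) m else partCount (N ∸ j) m)
  partCount-suc N m = trans (count-compositions-suc (hasParts m) N)
    (∑-cong (suc N) (λ j _ → firstPart j m))
    where
    firstPart : ∀ j m → + count (hasParts m ∘ (suc j ∷_)) (compositions (N ∸ j)) ≡
      (if j ≡ᵇ k0 then below partCount (N ∸ j) m else partCount (N ∸ j) m)
    firstPart j m
      rewrite count-cong (λ c → cong (_≡ᵇ m) (countParts-cons j c)) (compositions (N ∸ j))
      with j ≡ᵇ k0
    firstPart j zero    | true  = cong +_ (count-none (λ _ → refl) (compositions (N ∸ j)))
    firstPart j (suc m) | true  = refl
    firstPart j m       | false = refl

  partCount-vanish : ∀ F N m → N ≤ F → N < m ℕ.* k → partCount N m ≡ + 0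
  partCount-vanish F       zero    (suc m) _         _  = refl
  partCount-vanish (suc F) (suc N) (suc m) (s≤s N≤F) N<mk =
    trans (partCount-suc N (suc m)) (∑-zero (suc N) term)
    where
    term : ∀ j → j < suc N →
      (if j ≡ᵇ k0 then partCount (N ∸ j) m else partCount (N ∸ j) (suc m)) ≡ + 0
    term j (s≤s j≤N) with j ≡ᵇ k0 in isK
    ... | true  with refl ← ≡ᵇ-sound j k0 isK =
      partCount-vanish F (N ∸ k0) m (ℕP.≤-trans (ℕP.m∸n≤m N k0) N≤F) (after-k k0 N<mk j≤N)
    ... | false = partCount-vanish F (N ∸ j) (suc m) (ℕP.≤-trans (ℕP.m∸n≤m N j) N≤F)
      (ℕP.≤-<-trans (ℕP.m∸n≤m N j) (ℕP.<-trans (ℕP.n<1+n N) N<mk))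

  compositionCount : ℕ → ℕ → ℤ
  compositionCount n m = partCount (n ℕ.+ m ℕ.* k) m

  E≡compositionCount : ∀ n m → + E m (n ℕ.+ m ℕ.* k) k ≡ compositionCount n m
  E≡compositionCount n m = cong +_ (length-filter≡count _ (compositions (n ℕ.+ m ℕ.* k)))

  compositionCount-step : ∀ n m N → n ℕ.+ m ℕ.* k ≡ suc N →
    compositionCount n m ≡ unit n m + below compositionCount n m
                           + ∑[ _≢ᵇ k0 ] n (λ l → compositionCount (n ∸ suc l) m)
  compositionCount-step n m N total = begin
    compositionCount n m
      ≡⟨ cong (λ s → partCount s m) total ⟩
    partCount (suc N) m
      ≡⟨ partCount-suc N m ⟩
    ∑< (suc N) (λ j → if j ≡ᵇ k0 then below partCount (N ∸ j) m else partCount (N ∸ j) m)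
      ≡⟨ firstPartIsK m total ⟩
    ∑[ _≢ᵇ k0 ] (suc N) (λ j → partCount (N ∸ j) m) + below compositionCount n m
      ≡⟨ cong (_+ below compositionCount n m)
              (∑[]-truncate (_≢ᵇ k0) (summand≤total total) (λ j n≤j j<sN →
                partCount-vanish (N ∸ j) (N ∸ j) m ℕP.≤-refl
                  (remaining-long total n≤j (ℕP.≤-pred j<sN)))) ⟩
    ∑[ _≢ᵇ k0 ] n (λ j → partCount (N ∸ j) m) + below compositionCount n m
      ≡⟨ cong (_+ below compositionCount n m)
              (∑[]-cong (_≢ᵇ k0) n (λ j j<n →
                cong (λ s → partCount s m) (remaining-short total j<n))) ⟩
    ∑[ _≢ᵇ k0 ] n (λ l → compositionCount (n ∸ suc l) m) + below compositionCount n m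
      ≡⟨ ℤP.+-comm (∑[ _≢ᵇ k0 ] n (λ l → compositionCount (n ∸ suc l) m)) _ ⟩
    below compositionCount n m + ∑[ _≢ᵇ k0 ] n (λ l → compositionCount (n ∸ suc l) m)
      ≡⟨ add-unit {n} {m} total (λ m≡0 → cong (ℕ._* k) m≡0) _ _ ⟩
    unit n m + below compositionCount n m + ∑[ _≢ᵇ k0 ] n (λ l → compositionCount (n ∸ suc l) m)
      ∎
    where
    open ≡-Reasoning
    firstPartIsK : ∀ m → n ℕ.+ m ℕ.* k ≡ suc N →
      ∑< (suc N) (λ j → if j ≡ᵇ k0 then below partCount (N ∸ j) m else partCount (N ∸ j) m)
        ≡ ∑[ _≢ᵇ k0 ] (suc N) (λ j → partCount (N ∸ j) m) + below compositionCount n m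
    firstPartIsK zero     _      =
      trans (∑-select-zero k0 (suc N) (λ j → partCount (N ∸ j) zero)) (sym (ℤP.+-identityʳ _))
    firstPartIsK (suc m') total' =
      trans (∑-select k0 (suc N) (λ j → partCount (N ∸ j) m') (λ j → partCount (N ∸ j) (suc m'))
                     (s≤s (subst (k0 ℕ.≤_) (sym N≡) (ℕP.m≤m+n k0 _))))
            (cong (λ s → ∑[ _≢ᵇ k0 ] (suc N) (λ j → partCount (N ∸ j) (suc m'))
                         + partCount s m')
                  (trans (cong (_∸ k0) N≡) (ℕP.m+n∸m≡n k0 _)))
      where
      N≡ : N ≡ k0 ℕ.+ (n ℕ.+ m' ℕ.* k)
      N≡ = after-part k0 total'

  compositionCount-recurrence : Recurrence (_≢ᵇ k0) compositionCount
  compositionCount-recurrence zero    zero    = refl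
  compositionCount-recurrence zero    (suc m) = compositionCount-step zero (suc m) (k0 ℕ.+ m ℕ.* k) refl
  compositionCount-recurrence (suc n) m       = compositionCount-step (suc n) m (n ℕ.+ m ℕ.* k) refl

-- Each a(m+i, ·) is expanded
-- by the unrestricted tiling recurrence; Pascal's rule then turns the
-- "red square first" terms into the (n, m-1) sum minus the (n-k, m) sum,
-- and the latter removes exactly the forbidden term l = k0 of the convolution.
module AlternatingSum (k0 : ℕ) where

  open import Data.Integer using (_+_; _*_; -_; _-_)
  open import Data.Nat.Combinatorics using (_C_; nCn≡1; nCk+nC[k+1]≡[n+1]C[k+1]; k>n⇒nCk≡0)
  open Arithmetic
  open Counting
  open Sums
  open Recurrence
  open import Relation.Nullary using (yes; no)
  open import Data.Bool using (_∧_)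

  k : ℕ
  k = suc k0

  A : ℕ → ℤ → ℤ
  A r y = + a r y

  minus-pos : ∀ {n c} → c ≤ n → + n - + c ≡ + (n ∸ c)
  minus-pos {n} {c} c≤n = trans (ℤP.[+m]-[+n]≡m⊖n n c) (ℤP.⊖-≥ c≤n)

  minus-neg : ∀ {n c} → n < c → + n - + c ≡ -[1+ c ∸ suc n ]
  minus-neg {n} {suc c} (s≤s n≤c) = trans (ℤP.[+m]-[+n]≡m⊖n n (suc c))
    (trans (ℤP.⊖-< (s≤s n≤c)) (cong (λ d → - (+ d)) (ℕP.+-∸-assoc 1 n≤c)))

  A-negative : ∀ r {n c} → n < c → A r (+ n - + c) ≡ + 0
  A-negative r n<c rewrite minus-neg n<c = refl

  -- The two non-convolution terms of the tiling recurrence, extended to ℤ.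
  atZero : ℤ → ℤ
  atZero (+ zero)  = + 1
  atZero (+ suc _) = + 0
  atZero -[1+ _ ]  = + 0

  aUnit : ℕ → ℤ → ℤ
  aUnit zero    y = atZero y
  aUnit (suc _) _ = + 0

  aBelow : ℕ → ℤ → ℤ
  aBelow zero    _ = + 0
  aBelow (suc r) y = A r y

  unit≡aUnit : ∀ N r → unit N r ≡ aUnit r (+ N)
  unit≡aUnit zero    zero    = refl
  unit≡aUnit zero    (suc _) = refl
  unit≡aUnit (suc _) zero    = refl
  unit≡aUnit (suc _) (suc _) = refl

  A≡tilingCount : ∀ r N → A r (+ N) ≡ tilingCount (λ _ → true) N r
  A≡tilingCount r N = cong +_ (trans (length-filter≡count _ (tilings (N ℕ.+ r)))
    (count-cong (λ t → cong (_∧ ((reds t ≡ᵇ r) ∧ (whiteLen t ≡ᵇ N))) (sym (allAllowed t)))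
                (tilings (N ℕ.+ r))))
    where
    allAllowed : ∀ t → whitesAllowed (λ _ → true) t ≡ true
    allAllowed []            = refl
    allAllowed (red ∷ t)     = allAllowed t
    allAllowed (white _ ∷ t) = allAllowed t

  -- The unrestricted tiling recurrence for a(r, N), with the convolution
  -- written over any range l < L with L ≥ N (the extra terms vanish).
  A-step-nat : ∀ r N L → N ≤ L → A r (+ N) ≡
    aUnit r (+ N) + aBelow r (+ N) + ∑< L (λ l → A r (+ N - + suc l))
  A-step-nat r N L N≤L = begin
    A r (+ N)
      ≡⟨ A≡tilingCount r N ⟩
    tilingCount all N r
      ≡⟨ tilingCount-recurrence all N r ⟩
    unit N r + below (tilingCount all) N r + ∑< N (λ l → tilingCount all (N ∸ suc l) r)
      ≡⟨ cong₂ _+_ (cong₂ _+_ (unit≡aUnit N r) (below≡aBelow r))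
                   (∑-cong N (λ l l<N → trans (sym (A≡tilingCount r (N ∸ suc l)))
                                              (cong (A r) (sym (minus-pos l<N))))) ⟩
    aUnit r (+ N) + aBelow r (+ N) + ∑< N (λ l → A r (+ N - + suc l))
      ≡⟨ cong (λ s → aUnit r (+ N) + aBelow r (+ N) + s)
              (sym (∑-truncate N≤L (λ l N≤l _ → A-negative r (s≤s N≤l)))) ⟩
    aUnit r (+ N) + aBelow r (+ N) + ∑< L (λ l → A r (+ N - + suc l))
      ∎
    where
    open ≡-Reasoning
    all : ℕ → Bool
    all _ = true
    below≡aBelow : ∀ r → below (tilingCount all) N r ≡ aBelow r (+ N)
    below≡aBelow zero    = refl
    below≡aBelow (suc r) = sym (A≡tilingCount r N)

  A-step-neg : ∀ r z L → A r -[1+ z ] ≡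
    aUnit r -[1+ z ] + aBelow r -[1+ z ] + ∑< L (λ l → A r (-[1+ z ] - + suc l))
  A-step-neg zero    z L = sym (cong (λ s → + 0 + + 0 + s) (∑-zero L (λ _ _ → refl)))
  A-step-neg (suc r) z L = sym (cong (λ s → + 0 + + 0 + s) (∑-zero L (λ _ _ → refl)))

  A-step : ∀ r n c → A r (+ n - + c) ≡
    aUnit r (+ n - + c) + aBelow r (+ n - + c) + ∑< n (λ l → A r ((+ n - + c) - + suc l))
  A-step r n c with c ℕ.≤? n
  ... | yes c≤n rewrite minus-pos c≤n = A-step-nat r (n ∸ c) n (ℕP.m∸n≤m n c)
  ... | no  c≰n rewrite minus-neg (ℕP.≰⇒> c≰n) = A-step-neg r (c ∸ suc n) n

  coeff : ℕ → ℕ → ℤ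
  coeff m i = sgn i * + ((m ℕ.+ i) C m)

  term : ℕ → ℤ → ℕ → ℤ
  term m y i = coeff m i * A (m ℕ.+ i) (y - + (k ℕ.* i))

  altCount : ℕ → ℕ → ℤ
  altCount n m = ∑< (suc n) (term m (+ n))

  altSum≡altCount : ∀ n m → altSum n m k ≡ altCount n m
  altSum≡altCount n m = Σℤ≡∑< n (term m (+ n))

  sub-sub : ∀ (x a b : ℤ) → (x - a) - b ≡ x - (a + b)
  sub-sub = solve-∀

  sub-swap : ∀ (x a b : ℤ) → (x - a) - b ≡ (x - b) - a
  sub-swap = solve-∀

  term-vanish : ∀ m N i → N < i → term m (+ N) i ≡ + 0
  term-vanish m N i N<i =
    trans (cong (coeff m i *_) (A-negative (m ℕ.+ i) (ℕP.<-≤-trans N<i (ℕP.m≤m+n i (k0 ℕ.* i)))))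
          (ℤP.*-zeroʳ (coeff m i))

  altCount-stable : ∀ m {N B} → N < B → ∑< B (term m (+ N)) ≡ altCount N m
  altCount-stable m {N} N<B = ∑-truncate N<B (λ i N<i _ → term-vanish m N i N<i)

  -- Shifting i by one trades k for a sign: the term at i+1 for y is minus
  -- the term at i for y - k (with the same binomial coefficient c).
  shift : ∀ r n i (c : ℤ) →
    sgn (suc i) * c * A r (+ n - + (k ℕ.* suc i)) ≡ - (sgn i * c * A r ((+ n - + k) - + (k ℕ.* i)))
  shift r n i c = begin
    - sgn i * c * A r (+ n - + (k ℕ.* suc i))
      ≡⟨ cong (λ d → - sgn i * c * A r (+ n - + d)) (ℕP.*-suc k i) ⟩
    - sgn i * c * A r (+ n - (+ k + + (k ℕ.* i)))
      ≡⟨ cong (λ y → - sgn i * c * A r y) (sub-sub (+ n) (+ k) (+ (k ℕ.* i))) ⟨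
    - sgn i * c * A r ((+ n - + k) - + (k ℕ.* i))
      ≡⟨ neg-first (sgn i) c _ ⟩
    - (sgn i * c * A r ((+ n - + k) - + (k ℕ.* i)))
      ∎
    where
    open ≡-Reasoning
    neg-first : ∀ (s c x : ℤ) → - s * c * x ≡ - (s * c * x)
    neg-first = solve-∀

  term-step : ∀ m n i → term m (+ n) i ≡
      coeff m i * aUnit (m ℕ.+ i) (+ n - + (k ℕ.* i))
    + coeff m i * aBelow (m ℕ.+ i) (+ n - + (k ℕ.* i))
    + ∑< n (λ l → term m (+ n - + suc l) i)
  term-step m n i = begin
    c * A r y
      ≡⟨ cong (c *_) (A-step r n (k ℕ.* i)) ⟩
    c * (aUnit r y + aBelow r y + ∑< n (λ l → A r (y - + suc l)))
      ≡⟨ distrib c (aUnit r y) (aBelow r y) _ ⟩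
    c * aUnit r y + c * aBelow r y + c * ∑< n (λ l → A r (y - + suc l))
      ≡⟨ cong (λ s → c * aUnit r y + c * aBelow r y + s)
              (trans (∑-scale n c _) (∑-cong n (λ l _ →
                cong (λ v → c * A r v) (sub-swap (+ n) (+ (k ℕ.* i)) (+ suc l))))) ⟩
    c * aUnit r y + c * aBelow r y + ∑< n (λ l → term m (+ n - + suc l) i)
      ∎
    where
    open ≡-Reasoning
    c : ℤ
    c = coeff m i
    r : ℕ
    r = m ℕ.+ i
    y : ℤ
    y = + n - + (k ℕ.* i)
    distrib : ∀ (c u v w : ℤ) → c * (u + v + w) ≡ c * u + c * v + c * w
    distrib = solve-∀

  unit-part : ∀ m n →
    ∑< (suc n) (λ i → coeff m i * aUnit (m ℕ.+ i) (+ n - + (k ℕ.* i))) ≡ unit n m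
  unit-part m n =
    trans (cong₂ _+_ first (∑-zero n (λ i _ → later i))) (ℤP.+-identityʳ (unit n m))
    where
    first : coeff m 0 * aUnit (m ℕ.+ 0) (+ n - + (k ℕ.* 0)) ≡ unit n m
    first rewrite ℕP.+-identityʳ m | ℕP.*-zeroʳ k | ℤP.+-identityʳ (+ n) | nCn≡1 m =
      trans (ℤP.*-identityˡ _) (sym (unit≡aUnit n m))
    later : ∀ i → coeff m (suc i) * aUnit (m ℕ.+ suc i) (+ n - + (k ℕ.* suc i)) ≡ + 0
    later i = trans (cong (λ r → coeff m (suc i) * aUnit r (+ n - + (k ℕ.* suc i))) (ℕP.+-suc m i))
                    (ℤP.*-zeroʳ (coeff m (suc i)))

  -- By Pascal's rule the red-first parts give the sum for (n, m-1) minus the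
  -- sum for (n - k, m).
  below-part : ∀ m n →
    ∑< (suc n) (λ i → coeff m i * aBelow (m ℕ.+ i) (+ n - + (k ℕ.* i)))
      ≡ below altCount n m - ∑< n (term m (+ n - + k))
  below-part zero n = cong₂ _+_ (ℤP.*-zeroʳ (coeff 0 0))
    (trans (∑-cong n (λ i _ → shift i n i (+ (suc i C 0)))) (∑-neg n (term 0 (+ n - + k))))
  below-part (suc m) n = begin
    ∑< (suc n) (λ i → coeff (suc m) i * A (m ℕ.+ i) (y i))
      ≡⟨ ∑-cong (suc n) (λ i _ → pascal i) ⟩
    ∑< (suc n) (λ i → term m (+ n) i + fresh i)
      ≡⟨ ∑-+ (suc n) (term m (+ n)) fresh ⟩
    altCount n m + (fresh 0 + ∑< n (fresh ∘ suc))
      ≡⟨ cong (λ s → altCount n m + s) (cong₂ _+_ fresh-0 (∑-cong n (λ i _ → fresh-suc i))) ⟩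
    altCount n m + (+ 0 + ∑< n (λ i → - term (suc m) (+ n - + k) i))
      ≡⟨ cong (λ s → altCount n m + s)
              (trans (ℤP.+-identityˡ _) (∑-neg n (term (suc m) (+ n - + k)))) ⟩
    altCount n m - ∑< n (term (suc m) (+ n - + k))
      ∎
    where
    open ≡-Reasoning
    y : ℕ → ℤ
    y i = + n - + (k ℕ.* i)
    -- the part with the coefficient C(m+i, m+1) of Pascal's rule
    fresh : ℕ → ℤ
    fresh i = sgn i * + ((m ℕ.+ i) C suc m) * A (m ℕ.+ i) (y i)
    pascal : ∀ i → coeff (suc m) i * A (m ℕ.+ i) (y i) ≡ term m (+ n) i + fresh i
    pascal i = trans
      (cong (λ c → sgn i * + c * A (m ℕ.+ i) (y i)) (sym (nCk+nC[k+1]≡[n+1]C[k+1] (m ℕ.+ i) m)))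
      (distrib (sgn i) (+ ((m ℕ.+ i) C m)) (+ ((m ℕ.+ i) C suc m)) (A (m ℕ.+ i) (y i)))
      where
      distrib : ∀ (s p q x : ℤ) → s * (p + q) * x ≡ s * p * x + s * q * x
      distrib = solve-∀
    fresh-0 : fresh 0 ≡ + 0
    fresh-0 rewrite k>n⇒nCk≡0 (s≤s (ℕP.≤-reflexive (ℕP.+-identityʳ m))) =
      ℤP.*-zeroʳ (sgn 0 * + 0)
    fresh-suc : ∀ i → fresh (suc i) ≡ - term (suc m) (+ n - + k) i
    fresh-suc i rewrite ℕP.+-suc m i = shift (suc m ℕ.+ i) n i (+ ((suc m ℕ.+ i) C suc m))

  -- The sum at n - k is the omitted term l = k0 of the convolution.
  omit-k : ∀ m n →
    ∑< n (λ l → altCount (n ∸ suc l) m) - ∑< n (term m (+ n - + k))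
      ≡ ∑[ _≢ᵇ k0 ] n (λ l → altCount (n ∸ suc l) m)
  omit-k m n with k ℕ.≤? n
  ... | yes k≤n = begin
    ∑< n f - ∑< n (term m (+ n - + k))
      ≡⟨ cong₂ _-_ (∑-omit k0 n f k≤n) shifted ⟩
    (∑[ _≢ᵇ k0 ] n f + f k0) - f k0
      ≡⟨ cancel (∑[ _≢ᵇ k0 ] n f) (f k0) ⟩
    ∑[ _≢ᵇ k0 ] n f
      ∎
    where
    open ≡-Reasoning
    f : ℕ → ℤ
    f l = altCount (n ∸ suc l) m
    shifted : ∑< n (term m (+ n - + k)) ≡ f k0
    shifted rewrite minus-pos k≤n = altCount-stable m (ℕP.∸-monoʳ-< (s≤s z≤n) k≤n)
    cancel : ∀ (x y : ℤ) → (x + y) - y ≡ x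
    cancel = solve-∀
  ... | no k≰n = begin
    ∑< n f - ∑< n (term m (+ n - + k))
      ≡⟨ cong (λ s → ∑< n f - s) (∑-zero n (λ i _ → shifted-vanish i)) ⟩
    ∑< n f - + 0
      ≡⟨ ℤP.+-identityʳ (∑< n f) ⟩
    ∑< n f
      ≡⟨ ∑-omit-absent k0 n f (ℕP.≤-pred (ℕP.≰⇒> k≰n)) ⟨
    ∑[ _≢ᵇ k0 ] n f
      ∎
    where
    open ≡-Reasoning
    f : ℕ → ℤ
    f l = altCount (n ∸ suc l) m
    shifted-vanish : ∀ i → term m (+ n - + k) i ≡ + 0
    shifted-vanish i = trans
      (cong (λ y → coeff m i * A (m ℕ.+ i) y) (sub-sub (+ n) (+ k) (+ (k ℕ.* i))))
      (trans (cong (coeff m i *_)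
               (A-negative (m ℕ.+ i) (ℕP.<-≤-trans (ℕP.≰⇒> k≰n) (ℕP.m≤m+n k (k ℕ.* i)))))
             (ℤP.*-zeroʳ (coeff m i)))

  altCount-recurrence : Recurrence (_≢ᵇ k0) altCount
  altCount-recurrence n m = begin
    altCount n m
      ≡⟨ ∑-cong (suc n) (λ i _ → term-step m n i) ⟩
    ∑< (suc n) (λ i → U i + V i + W i)
      ≡⟨ trans (∑-+ (suc n) (λ i → U i + V i) W) (cong (_+ ∑< (suc n) W) (∑-+ (suc n) U V)) ⟩
    ∑< (suc n) U + ∑< (suc n) V + ∑< (suc n) W
      ≡⟨ cong₂ _+_ (cong₂ _+_ (unit-part m n) (below-part m n)) convolution ⟩
    unit n m + (below altCount n m - S) + ∑< n (λ l → altCount (n ∸ suc l) m)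
      ≡⟨ regroup (unit n m) (below altCount n m) S _ ⟩
    unit n m + below altCount n m + (∑< n (λ l → altCount (n ∸ suc l) m) - S)
      ≡⟨ cong (λ s → unit n m + below altCount n m + s) (omit-k m n) ⟩
    unit n m + below altCount n m + ∑[ _≢ᵇ k0 ] n (λ l → altCount (n ∸ suc l) m)
      ∎
    where
    open ≡-Reasoning
    U V W : ℕ → ℤ
    U i = coeff m i * aUnit (m ℕ.+ i) (+ n - + (k ℕ.* i))
    V i = coeff m i * aBelow (m ℕ.+ i) (+ n - + (k ℕ.* i))
    W i = ∑< n (λ l → term m (+ n - + suc l) i)
    S : ℤ
    S = ∑< n (term m (+ n - + k))
    convolution : ∑< (suc n) W ≡ ∑< n (λ l → altCount (n ∸ suc l) m)
    convolution = trans (∑-swap (suc n) n (λ i l → term m (+ n - + suc l) i))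
      (∑-cong n (λ l l<n → trans (cong (λ y → ∑< (suc n) (term m y)) (minus-pos l<n))
                                 (altCount-stable m (s≤s (ℕP.m∸n≤m n (suc l))))))
    regroup : ∀ (u b s c : ℤ) → u + (b - s) + c ≡ u + b + (c - s)
    regroup = solve-∀

open Recurrence using (recurrence-unique; tilingCount; tilingCount-recurrence)
open Sums using (_≢ᵇ_)
open import Data.Nat using (_+_; _*_)
open import Data.Product using (_×_; _,_)

-- All three quantities solve the recurrence with white length k forbidden,
-- so they agree.
mainTheorem2 : (n m k : ℕ) → 1 ≤ k →
    (Chat n m k ≡ E m (n + m * k) k) × (+ E m (n + m * k) k ≡ altSum n m k)
mainTheorem2 n m (suc k0) (s≤s z≤n) = ℤP.+-injective Chat≡E , E≡altSum
  where
  open ≡-Reasoning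
  open ForbiddenLength k0 using (k; compositionCount; compositionCount-recurrence;
                                 Chat≡tilingCount; E≡compositionCount)
  open AlternatingSum k0 using (altCount; altCount-recurrence; altSum≡altCount)

  Chat≡E : + Chat n m k ≡ + E m (n + m * k) k
  Chat≡E = begin
    + Chat n m k              ≡⟨ Chat≡tilingCount n m ⟩
    tilingCount (_≢ᵇ k0) n m  ≡⟨ recurrence-unique (tilingCount-recurrence (_≢ᵇ k0))
                                                   compositionCount-recurrence n m ⟩
    compositionCount n m      ≡⟨ E≡compositionCount n m ⟨
    + E m (n + m * k) k       ∎

  E≡altSum : + E m (n + m * k) k ≡ altSum n m k
  E≡altSum = begin
    + E m (n + m * k) k       ≡⟨ E≡compositionCount n m ⟩
    compositionCount n m      ≡⟨ recurrence-unique compositionCount-recurrence altCount-recurrence n m ⟩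
    altCount n m              ≡⟨ altSum≡altCount n m ⟨
    altSum n m k              ∎
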